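{- For all integers $0 \le i \le j$ and $r \ge 0$, \[ \sum_{t=0}^{j} \frac{1}{t! \, (j+1-t)} \genfrac{[}{]}{0pt}{}{t+r}{i+r}_{r} = \frac{i+1}{(j+1)!} \genfrac{[}{]}{0pt}{}{j+r+1}{i+r+1}_{r}. \]
   Context: For an integer $r\ge 0$, $\genfrac{[}{]}{0pt}{}{a}{b}_{r}$ denotes the $r$-Stirling number of the first kind: the number of permutations of $\{1,\dots,a\}$ having exactly $b$ cycles such that the elements $1,\dots,r$ lie in distinct cycles (for $r=0$ it is the ordinary unsigned Stirling number of the first kind, with $\genfrac{[}{]}{0pt}{}{0}{0}=1$); it is $0$ when $b>a$. -}

module Defs where

open import Data.Nat using (ℕ; zero; suc; _+_; _*_; _∸_; _!; _≤ᵇ_)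
open import Data.Nat.Properties using (_!≢0; m*n≢0)
open import Data.Bool using (if_then_else_)
open import Data.Integer using (+_)
open import Data.Rational using (ℚ; _/_; 0ℚ) renaming (_+_ to _+ℚ_; _*_ to _*ℚ_)
open import Data.List using (List; map; foldr; upTo)

-- Auxiliary: rStirAux r m k = [ r + m , k ]_r  (r-Stirling number of the first kind),
-- by the standard recurrence on the number of elements:
--   [ r , k ]_r = 1 if k = r, 0 otherwise (only the identity permutation of r
--                 elements keeps 1..r in distinct cycles; it has r cycles);
--   [ n+1 , k ]_r = n [ n , k ]_r + [ n , k-1 ]_r   for n ≥ r
--   (insert n+1 after one of n elements, or as a new fixed point).
rStirAux : ℕ → ℕ → ℕ → ℕ
rStirAux r zero k = if (r ≤ᵇ k) then (if (k ≤ᵇ r) then 1 else 0) else 0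
rStirAux r (suc m) zero = (r + m) * rStirAux r m zero
rStirAux r (suc m) (suc k) = (r + m) * rStirAux r m (suc k) + rStirAux r m k

-- rStir r a b = [ a , b ]_r ; defined as 0 when a < r (never used below).
rStir : ℕ → ℕ → ℕ → ℕ
rStir r a b = if (r ≤ᵇ a) then rStirAux r (a ∸ r) b else 0

sumℚ : List ℚ → ℚ
sumℚ = foldr _+ℚ_ 0ℚ

sumTo : ℕ → (ℕ → ℚ) → ℚ
sumTo j f = sumℚ (map f (upTo (suc j)))

frac! : ℕ → ℕ → ℕ → ℚ
frac! n m d = (+ n / (m ! * suc d)) {{m*n≢0 (m !) (suc d) {{m !≢0}}}}

div! : ℕ → ℕ → ℚ
div! n m = (+ n / (m !)) {{m !≢0}}

-- Let L(x) = −log(1 − x) = Σ_{d ≥ 1} xᵈ / d.  The normalised r-Stirling numbers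
-- [t + r, i + r]_r / t! are the coefficients of Aᵢ = (1 − x)^{−r} Lⁱ / i!, so L Aᵢ = (i + 1) Aᵢ₊₁,
-- and the identity is the coefficient of x^{j+1} of this.  No power series are needed: the
-- recurrence of the r-Stirling numbers reads (1 − x) Aᵢ′ = r Aᵢ + Aᵢ₋₁, which together with
-- (1 − x) L′ = 1 gives a recurrence for the coefficients of L Aᵢ, and L Aᵢ = (i + 1) Aᵢ₊₁
-- follows by induction on the coefficient index.
module Submission where

open import Defs
open import Data.Bool using (false; true; T; if_then_else_)
open import Data.Bool.Properties using (if-cong; if-cong-then; if-eta)
open import Data.Integer using (+_) renaming (_+_ to _+ℤ_; _*_ to _*ℤ_)
import Data.Integer.Properties as ℤ
open import Data.List using (map; applyUpTo)
open import Data.Nat using (ℕ; zero; suc; _+_; _*_; _∸_; _≤_; _<_; _!; _≤ᵇ_; NonZero; z≤n; s≤s)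
import Data.Nat.Properties as ℕ
open import Data.Nat.Tactic.RingSolver using (solve-∀)
open import Data.Rational using (ℚ; 0ℚ; 1ℚ; _/_; toℚᵘ; fromℚᵘ)
  renaming (_+_ to _+ℚ_; _*_ to _*ℚ_; _-_ to _-ℚ_)
import Data.Rational.Properties as ℚ
open import Data.Rational.Solver using (module +-*-Solver)
open import Data.Rational.Unnormalised as ℚᵘ using (mkℚᵘ; *≡*)
import Data.Rational.Unnormalised.Properties as ℚᵘ
open import Data.Unit using (tt)
open import Function using (_∘_; id)
open import Relation.Nullary using (contradiction)
open import Relation.Binary.PropositionalEquality

open +-*-Solver using (solve; _:=_; _:+_; _:*_; _:-_; con)

fromℚᵘ-homo-* : ∀ p q → fromℚᵘ (p ℚᵘ.* q) ≡ fromℚᵘ p *ℚ fromℚᵘ q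
fromℚᵘ-homo-* p q = ℚ.toℚᵘ-injective (begin
  toℚᵘ (fromℚᵘ (p ℚᵘ.* q))              ≈⟨ ℚ.toℚᵘ-fromℚᵘ (p ℚᵘ.* q) ⟩
  p ℚᵘ.* q                              ≈⟨ ℚᵘ.*-cong (ℚ.toℚᵘ-fromℚᵘ p) (ℚ.toℚᵘ-fromℚᵘ q) ⟨
  toℚᵘ (fromℚᵘ p) ℚᵘ.* toℚᵘ (fromℚᵘ q)  ≈⟨ ℚ.toℚᵘ-homo-* (fromℚᵘ p) (fromℚᵘ q) ⟨
  toℚᵘ (fromℚᵘ p *ℚ fromℚᵘ q)           ∎)
  where open ℚᵘ.≃-Reasoning

fromℚᵘ-homo-+ : ∀ p q → fromℚᵘ (p ℚᵘ.+ q) ≡ fromℚᵘ p +ℚ fromℚᵘ q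
fromℚᵘ-homo-+ p q = ℚ.toℚᵘ-injective (begin
  toℚᵘ (fromℚᵘ (p ℚᵘ.+ q))              ≈⟨ ℚ.toℚᵘ-fromℚᵘ (p ℚᵘ.+ q) ⟩
  p ℚᵘ.+ q                              ≈⟨ ℚᵘ.+-cong (ℚ.toℚᵘ-fromℚᵘ p) (ℚ.toℚᵘ-fromℚᵘ q) ⟨
  toℚᵘ (fromℚᵘ p) ℚᵘ.+ toℚᵘ (fromℚᵘ q)  ≈⟨ ℚ.toℚᵘ-homo-+ (fromℚᵘ p) (fromℚᵘ q) ⟨
  toℚᵘ (fromℚᵘ p +ℚ fromℚᵘ q)           ∎)
  where open ℚᵘ.≃-Reasoning

/-*-/ : ∀ a b c d .{{_ : NonZero b}} .{{_ : NonZero d}} →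
        (+ a / b) *ℚ (+ c / d) ≡ (+ (a * c) / (b * d)) {{ℕ.m*n≢0 b d}}
/-*-/ a (suc b) c (suc d) = begin
  (+ a / suc b) *ℚ (+ c / suc d)     ≡⟨ fromℚᵘ-homo-* (mkℚᵘ (+ a) b) (mkℚᵘ (+ c) d) ⟨
  (+ a *ℤ + c) / (suc b * suc d)     ≡⟨ cong (_/ (suc b * suc d)) (ℤ.pos-* a c) ⟨
  + (a * c) / (suc b * suc d)        ∎
  where open ≡-Reasoning

/-+-/ : ∀ a b c d .{{_ : NonZero b}} .{{_ : NonZero d}} →
        (+ a / b) +ℚ (+ c / d) ≡ (+ (a * d + c * b) / (b * d)) {{ℕ.m*n≢0 b d}}
/-+-/ a (suc b) c (suc d) = begin
  (+ a / suc b) +ℚ (+ c / suc d)                       ≡⟨ fromℚᵘ-homo-+ (mkℚᵘ (+ a) b) (mkℚᵘ (+ c) d) ⟨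
  (+ a *ℤ + suc d +ℤ + c *ℤ + suc b) / (suc b * suc d) ≡⟨ cong (_/ (suc b * suc d)) numerator ⟨
  + (a * suc d + c * suc b) / (suc b * suc d)          ∎
  where
  open ≡-Reasoning
  numerator : + (a * suc d + c * suc b) ≡ + a *ℤ + suc d +ℤ + c *ℤ + suc b
  numerator = trans (ℤ.pos-+ (a * suc d) (c * suc b))
                    (cong₂ _+ℤ_ (ℤ.pos-* a (suc d)) (ℤ.pos-* c (suc b)))

/≡/ : ∀ a b c d .{{_ : NonZero b}} .{{_ : NonZero d}} →
      a * d ≡ c * b → + a / b ≡ + c / d
/≡/ a (suc b) c (suc d) ad≡cb = ℚ.fromℚᵘ-cong {mkℚᵘ (+ a) b} {mkℚᵘ (+ c) d} (*≡* (begin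
  + a *ℤ + suc d  ≡⟨ ℤ.pos-* a (suc d) ⟨
  + (a * suc d)   ≡⟨ cong +_ ad≡cb ⟩
  + (c * suc b)   ≡⟨ ℤ.pos-* c (suc b) ⟩
  + c *ℤ + suc b  ∎))
  where open ≡-Reasoning

fromℕ : ℕ → ℚ
fromℕ n = + n / 1

1/suc : ℕ → ℚ
1/suc d = + 1 / suc d

fromℕ-+ : ∀ m n → fromℕ (m + n) ≡ fromℕ m +ℚ fromℕ n
fromℕ-+ m n = sym (trans (/-+-/ m 1 n 1) (/≡/ (m * 1 + n * 1) 1 (m + n) 1 (arith m n)))
  where
  arith : ∀ m n → (m * 1 + n * 1) * 1 ≡ (m + n) * (1 * 1)
  arith = solve-∀

fromℕ-suc*1/suc : ∀ d → fromℕ (suc d) *ℚ 1/suc d ≡ 1ℚ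
fromℕ-suc*1/suc d = trans (/-*-/ (suc d) 1 1 (suc d)) (/≡/ (suc d * 1) (1 * suc d) 1 1 (arith d))
  where
  arith : ∀ d → suc d * 1 * 1 ≡ 1 * (1 * suc d)
  arith = solve-∀

*-cancelˡ-fromℕ-suc : ∀ d {p q} → fromℕ (suc d) *ℚ p ≡ fromℕ (suc d) *ℚ q → p ≡ q
*-cancelˡ-fromℕ-suc d {p} {q} dp≡dq = begin
  p                                ≡⟨ ℚ.*-identityˡ p ⟨
  1ℚ *ℚ p                          ≡⟨ cong (_*ℚ p) 1/d*d≡1 ⟨
  1/suc d *ℚ fromℕ (suc d) *ℚ p    ≡⟨ ℚ.*-assoc (1/suc d) (fromℕ (suc d)) p ⟩
  1/suc d *ℚ (fromℕ (suc d) *ℚ p)  ≡⟨ cong (1/suc d *ℚ_) dp≡dq ⟩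
  1/suc d *ℚ (fromℕ (suc d) *ℚ q)  ≡⟨ ℚ.*-assoc (1/suc d) (fromℕ (suc d)) q ⟨
  1/suc d *ℚ fromℕ (suc d) *ℚ q    ≡⟨ cong (_*ℚ q) 1/d*d≡1 ⟩
  1ℚ *ℚ q                          ≡⟨ ℚ.*-identityˡ q ⟩
  q                                ∎
  where
  open ≡-Reasoning
  1/d*d≡1 : 1/suc d *ℚ fromℕ (suc d) ≡ 1ℚ
  1/d*d≡1 = trans (ℚ.*-comm (1/suc d) (fromℕ (suc d))) (fromℕ-suc*1/suc d)

frac!≡div!*1/suc : ∀ n t d → frac! n t d ≡ div! n t *ℚ 1/suc d
frac!≡div!*1/suc n t d = sym (trans (/-*-/ n (t !) 1 (suc d) {{t ℕ.!≢0}})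
  (/≡/ (n * 1) (t ! * suc d) n (t ! * suc d) {{ℕ.m*n≢0 (t !) (suc d) {{t ℕ.!≢0}}}}
       {{ℕ.m*n≢0 (t !) (suc d) {{t ℕ.!≢0}}}} (cong (_* (t ! * suc d)) (ℕ.*-identityʳ n))))

fromℕ*div! : ∀ k x t → fromℕ k *ℚ div! x t ≡ div! (k * x) t
fromℕ*div! k x t = trans (/-*-/ k 1 x (t !) {{_}} {{t ℕ.!≢0}})
  (/≡/ (k * x) (1 * t !) (k * x) (t !) {{ℕ.m*n≢0 1 (t !) {{_}} {{t ℕ.!≢0}}}} {{t ℕ.!≢0}}
       (cong (k * x *_) (sym (ℕ.*-identityˡ (t !)))))

div!-+ : ∀ x y t → div! x t +ℚ div! y t ≡ div! (x + y) t
div!-+ x y t = trans (/-+-/ x (t !) y (t !) {{t ℕ.!≢0}} {{t ℕ.!≢0}})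
  (/≡/ (x * t ! + y * t !) (t ! * t !) (x + y) (t !) {{ℕ.m*n≢0 (t !) (t !) {{t ℕ.!≢0}} {{t ℕ.!≢0}}}} {{t ℕ.!≢0}}
       (arith x y (t !)))
  where
  arith : ∀ x y f → (x * f + y * f) * f ≡ (x + y) * (f * f)
  arith = solve-∀

div!-0 : ∀ t → div! 0 t ≡ 0ℚ
div!-0 t = ℚ.0/n≡0 (t !) {{t ℕ.!≢0}}

fromℕ-suc*div!-suc : ∀ x t → fromℕ (suc t) *ℚ div! x (suc t) ≡ div! x t
fromℕ-suc*div!-suc x t = trans (fromℕ*div! (suc t) x (suc t))
  (/≡/ (suc t * x) (suc t !) x (t !) {{suc t ℕ.!≢0}} {{t ℕ.!≢0}} (arith x t (t !)))
  where
  arith : ∀ x t f → suc t * x * f ≡ x * (suc t * f)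
  arith = solve-∀

div!-recurrence : ∀ c x y z t → x ≡ c * y + z →
  fromℕ (suc t) *ℚ div! x (suc t) ≡ fromℕ c *ℚ div! y t +ℚ div! z t
div!-recurrence c x y z t x≡cy+z = begin
  fromℕ (suc t) *ℚ div! x (suc t)  ≡⟨ fromℕ-suc*div!-suc x t ⟩
  div! x t                         ≡⟨ cong (λ n → div! n t) x≡cy+z ⟩
  div! (c * y + z) t               ≡⟨ div!-+ (c * y) z t ⟨
  div! (c * y) t +ℚ div! z t       ≡⟨ cong (_+ℚ div! z t) (fromℕ*div! c y t) ⟨
  fromℕ c *ℚ div! y t +ℚ div! z t  ∎
  where open ≡-Reasoning

Σ< : ℕ → (ℕ → ℚ) → ℚ
Σ< zero    f = 0ℚ
Σ< (suc n) f = f 0 +ℚ Σ< n (f ∘ suc)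

sumℚ-map-applyUpTo : ∀ (f : ℕ → ℚ) g n → sumℚ (map f (applyUpTo g n)) ≡ Σ< n (f ∘ g)
sumℚ-map-applyUpTo f g zero    = refl
sumℚ-map-applyUpTo f g (suc n) = cong (f (g 0) +ℚ_) (sumℚ-map-applyUpTo f (g ∘ suc) n)

sumTo≡Σ< : ∀ j f → sumTo j f ≡ Σ< (suc j) f
sumTo≡Σ< j f = sumℚ-map-applyUpTo f id (suc j)

Σ<-cong : ∀ n {f g : ℕ → ℚ} → (∀ t → t < n → f t ≡ g t) → Σ< n f ≡ Σ< n g
Σ<-cong zero    f≗g = refl
Σ<-cong (suc n) f≗g =
  cong₂ _+ℚ_ (f≗g 0 (s≤s z≤n)) (Σ<-cong n (λ t t<n → f≗g (suc t) (s≤s t<n)))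

Σ<-distrib-+ : ∀ n (f g : ℕ → ℚ) → Σ< n (λ t → f t +ℚ g t) ≡ Σ< n f +ℚ Σ< n g
Σ<-distrib-+ zero    f g = refl
Σ<-distrib-+ (suc n) f g = begin
  (f 0 +ℚ g 0) +ℚ Σ< n (λ t → f (suc t) +ℚ g (suc t))  ≡⟨ cong ((f 0 +ℚ g 0) +ℚ_) (Σ<-distrib-+ n (f ∘ suc) (g ∘ suc)) ⟩
  (f 0 +ℚ g 0) +ℚ (Σ< n (f ∘ suc) +ℚ Σ< n (g ∘ suc))   ≡⟨ interchange (f 0) (g 0) (Σ< n (f ∘ suc)) (Σ< n (g ∘ suc)) ⟩
  (f 0 +ℚ Σ< n (f ∘ suc)) +ℚ (g 0 +ℚ Σ< n (g ∘ suc))   ∎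
  where
  open ≡-Reasoning
  interchange : ∀ a b c d → (a +ℚ b) +ℚ (c +ℚ d) ≡ (a +ℚ c) +ℚ (b +ℚ d)
  interchange = solve 4 (λ a b c d → (a :+ b) :+ (c :+ d) := (a :+ c) :+ (b :+ d)) refl

*-distribˡ-Σ< : ∀ n c (f : ℕ → ℚ) → c *ℚ Σ< n f ≡ Σ< n (λ t → c *ℚ f t)
*-distribˡ-Σ< zero    c f = ℚ.*-zeroʳ c
*-distribˡ-Σ< (suc n) c f =
  trans (ℚ.*-distribˡ-+ c (f 0) (Σ< n (f ∘ suc))) (cong (c *ℚ f 0 +ℚ_) (*-distribˡ-Σ< n c (f ∘ suc)))

Σ<-telescope : ∀ n (f : ℕ → ℚ) → Σ< n (λ t → f (suc t) -ℚ f t) ≡ f n -ℚ f 0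
Σ<-telescope zero    f = sym (ℚ.+-inverseʳ (f 0))
Σ<-telescope (suc n) f = begin
  (f 1 -ℚ f 0) +ℚ Σ< n (λ t → f (suc (suc t)) -ℚ f (suc t))  ≡⟨ cong ((f 1 -ℚ f 0) +ℚ_) (Σ<-telescope n (f ∘ suc)) ⟩
  (f 1 -ℚ f 0) +ℚ (f (suc n) -ℚ f 1)                         ≡⟨ chain (f 0) (f 1) (f (suc n)) ⟩
  f (suc n) -ℚ f 0                                           ∎
  where
  open ≡-Reasoning
  chain : ∀ a b c → (b -ℚ a) +ℚ (c -ℚ b) ≡ c -ℚ a
  chain = solve 3 (λ a b c → (b :- a) :+ (c :- b) := c :- a) refl

-- The n-th coefficient of L(x) · Σₜ a(t) xᵗ.
logConv : (ℕ → ℚ) → ℕ → ℚ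
logConv a n = Σ< n (λ t → a t *ℚ 1/suc (n ∸ suc t))

-- With δ = n − t we have n + 1 = δ + (t + 1), ρ + n = (ρ + t) + δ and δ · 1/δ = 1.
logConv-summand : ∀ ρ {n t} (a₀ a₁ b : ℚ) → t < n →
  fromℕ (suc t) *ℚ a₁ ≡ fromℕ (ρ + t) *ℚ a₀ +ℚ b →
  fromℕ (suc n) *ℚ (a₁ *ℚ 1/suc (n ∸ suc t))
    ≡ (a₁ -ℚ a₀) +ℚ (fromℕ (ρ + n) *ℚ (a₀ *ℚ 1/suc (n ∸ suc t)) +ℚ b *ℚ 1/suc (n ∸ suc t))
logConv-summand ρ {n} {t} a₀ a₁ b t<n a-rec = begin
  N *ℚ (a₁ *ℚ w)                                  ≡⟨ cong (_*ℚ (a₁ *ℚ w)) N≡δ+τ ⟩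
  (δ +ℚ τ) *ℚ (a₁ *ℚ w)                           ≡⟨ expand δ τ a₁ w ⟩
  δ *ℚ (a₁ *ℚ w) +ℚ (τ *ℚ a₁) *ℚ w                ≡⟨ cong (λ u → δ *ℚ (a₁ *ℚ w) +ℚ u *ℚ w) a-rec ⟩
  δ *ℚ (a₁ *ℚ w) +ℚ (R *ℚ a₀ +ℚ b) *ℚ w           ≡⟨ regroup δ R a₁ a₀ b w ⟩
  (a₁ -ℚ a₀) *ℚ (δ *ℚ w) +ℚ ((R +ℚ δ) *ℚ (a₀ *ℚ w) +ℚ b *ℚ w)
      ≡⟨ cong₂ (λ u v → (a₁ -ℚ a₀) *ℚ u +ℚ (v *ℚ (a₀ *ℚ w) +ℚ b *ℚ w)) (fromℕ-suc*1/suc d) (sym P≡R+δ) ⟩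
  (a₁ -ℚ a₀) *ℚ 1ℚ +ℚ (P *ℚ (a₀ *ℚ w) +ℚ b *ℚ w)  ≡⟨ cong (_+ℚ (P *ℚ (a₀ *ℚ w) +ℚ b *ℚ w)) (ℚ.*-identityʳ (a₁ -ℚ a₀)) ⟩
  (a₁ -ℚ a₀) +ℚ (P *ℚ (a₀ *ℚ w) +ℚ b *ℚ w)        ∎
  where
  open ≡-Reasoning
  d : ℕ
  d = n ∸ suc t
  w N P δ τ R : ℚ
  w = 1/suc d
  N = fromℕ (suc n)
  P = fromℕ (ρ + n)
  δ = fromℕ (suc d)
  τ = fromℕ (suc t)
  R = fromℕ (ρ + t)

  d+t+1≡n : d + suc t ≡ n
  d+t+1≡n = ℕ.m∸n+n≡m t<n

  N≡δ+τ : N ≡ δ +ℚ τ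
  N≡δ+τ = trans (cong (fromℕ ∘ suc) (sym d+t+1≡n)) (fromℕ-+ (suc d) (suc t))

  P≡R+δ : P ≡ R +ℚ δ
  P≡R+δ = trans (cong (λ m → fromℕ (ρ + m)) (sym d+t+1≡n))
                (trans (cong fromℕ (arith ρ d t)) (fromℕ-+ (ρ + t) (suc d)))
    where
    arith : ∀ ρ d t → ρ + (d + suc t) ≡ ρ + t + suc d
    arith = solve-∀

  expand : ∀ δ τ a₁ w → (δ +ℚ τ) *ℚ (a₁ *ℚ w) ≡ δ *ℚ (a₁ *ℚ w) +ℚ (τ *ℚ a₁) *ℚ w
  expand = solve 4 (λ δ τ a₁ w → (δ :+ τ) :* (a₁ :* w) := δ :* (a₁ :* w) :+ (τ :* a₁) :* w) refl

  regroup : ∀ δ R a₁ a₀ b w → δ *ℚ (a₁ *ℚ w) +ℚ (R *ℚ a₀ +ℚ b) *ℚ w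
                              ≡ (a₁ -ℚ a₀) *ℚ (δ *ℚ w) +ℚ ((R +ℚ δ) *ℚ (a₀ *ℚ w) +ℚ b *ℚ w)
  regroup = solve 6 (λ δ R a₁ a₀ b w → δ :* (a₁ :* w) :+ (R :* a₀ :+ b) :* w
                                      := (a₁ :- a₀) :* (δ :* w) :+ ((R :+ δ) :* (a₀ :* w) :+ b :* w)) refl

-- The coefficient form of:  (1 − x) A′ = ρ A + B  implies  (1 − x)(L A)′ = ρ L A + L B + A.
logConv-suc : ∀ ρ (a b : ℕ → ℚ) →
  (∀ t → fromℕ (suc t) *ℚ a (suc t) ≡ fromℕ (ρ + t) *ℚ a t +ℚ b t) →
  ∀ n → fromℕ (suc n) *ℚ logConv a (suc n) ≡ a n +ℚ fromℕ (ρ + n) *ℚ logConv a n +ℚ logConv b n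
logConv-suc ρ a b a-rec n = begin
  N *ℚ (a 0 *ℚ 1/suc n +ℚ Σ< n F)                    ≡⟨ ℚ.*-distribˡ-+ N (a 0 *ℚ 1/suc n) (Σ< n F) ⟩
  N *ℚ (a 0 *ℚ 1/suc n) +ℚ N *ℚ Σ< n F               ≡⟨ cong₂ _+ℚ_ first-term (*-distribˡ-Σ< n N F) ⟩
  a 0 +ℚ Σ< n (λ t → N *ℚ F t)
      ≡⟨ cong (a 0 +ℚ_) (Σ<-cong n (λ t t<n → logConv-summand ρ (a t) (a (suc t)) (b t) t<n (a-rec t))) ⟩
  a 0 +ℚ Σ< n (λ t → (a (suc t) -ℚ a t) +ℚ G t)      ≡⟨ cong (a 0 +ℚ_) (Σ<-distrib-+ n (λ t → a (suc t) -ℚ a t) G) ⟩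
  a 0 +ℚ ((Σ< n (λ t → a (suc t) -ℚ a t)) +ℚ Σ< n G) ≡⟨ cong₂ (λ u v → a 0 +ℚ (u +ℚ v)) (Σ<-telescope n a) (Σ<-distrib-+ n _ _) ⟩
  a 0 +ℚ ((a n -ℚ a 0) +ℚ (Σ< n (λ t → P *ℚ (a t *ℚ W t)) +ℚ logConv b n))
      ≡⟨ cong (λ u → a 0 +ℚ ((a n -ℚ a 0) +ℚ (u +ℚ logConv b n))) (*-distribˡ-Σ< n P (λ t → a t *ℚ W t)) ⟨
  a 0 +ℚ ((a n -ℚ a 0) +ℚ (P *ℚ logConv a n +ℚ logConv b n))
      ≡⟨ cancel-a₀ (a 0) (a n) (P *ℚ logConv a n) (logConv b n) ⟩
  a n +ℚ P *ℚ logConv a n +ℚ logConv b n             ∎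
  where
  open ≡-Reasoning
  N P : ℚ
  N = fromℕ (suc n)
  P = fromℕ (ρ + n)
  W F G : ℕ → ℚ
  W t = 1/suc (n ∸ suc t)
  F t = a (suc t) *ℚ W t
  G t = P *ℚ (a t *ℚ W t) +ℚ b t *ℚ W t

  first-term : N *ℚ (a 0 *ℚ 1/suc n) ≡ a 0
  first-term = begin
    N *ℚ (a 0 *ℚ 1/suc n)  ≡⟨ solve 3 (λ x y z → x :* (y :* z) := y :* (x :* z)) refl N (a 0) (1/suc n) ⟩
    a 0 *ℚ (N *ℚ 1/suc n)  ≡⟨ cong (a 0 *ℚ_) (fromℕ-suc*1/suc n) ⟩
    a 0 *ℚ 1ℚ              ≡⟨ ℚ.*-identityʳ (a 0) ⟩
    a 0                    ∎

  cancel-a₀ : ∀ a₀ aₙ x y → a₀ +ℚ ((aₙ -ℚ a₀) +ℚ (x +ℚ y)) ≡ aₙ +ℚ x +ℚ y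
  cancel-a₀ = solve 4 (λ a₀ aₙ x y → a₀ :+ ((aₙ :- a₀) :+ (x :+ y)) := aₙ :+ x :+ y) refl

previous : (ℕ → ℕ → ℚ) → ℕ → ℕ → ℚ
previous a zero    t = 0ℚ
previous a (suc i) t = a i t

-- If a i has generating function (1 − x)^{−ρ} Lⁱ / i!, then L · a i = (i + 1) · a (i + 1).
logConv-ladder : ∀ ρ (a : ℕ → ℕ → ℚ) → (∀ i → a (suc i) 0 ≡ 0ℚ) →
  (∀ i t → fromℕ (suc t) *ℚ a i (suc t) ≡ fromℕ (ρ + t) *ℚ a i t +ℚ previous a i t) →
  ∀ i n → logConv (a i) n ≡ fromℕ (suc i) *ℚ a (suc i) n
logConv-ladder ρ a a-suc-0 a-rec i zero = begin
  0ℚ                           ≡⟨ ℚ.*-zeroʳ (fromℕ (suc i)) ⟨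
  fromℕ (suc i) *ℚ 0ℚ          ≡⟨ cong (fromℕ (suc i) *ℚ_) (a-suc-0 i) ⟨
  fromℕ (suc i) *ℚ a (suc i) 0 ∎
  where open ≡-Reasoning
logConv-ladder ρ a a-suc-0 a-rec i (suc m) = *-cancelˡ-fromℕ-suc m (begin
  M *ℚ logConv (a i) (suc m)
      ≡⟨ logConv-suc ρ (a i) (previous a i) (a-rec i) m ⟩
  a i m +ℚ R *ℚ logConv (a i) m +ℚ logConv (previous a i) m
      ≡⟨ cong₂ (λ u v → a i m +ℚ R *ℚ u +ℚ v) (logConv-ladder ρ a a-suc-0 a-rec i m) (logConv-previous i) ⟩
  a i m +ℚ R *ℚ (I₊ *ℚ a (suc i) m) +ℚ fromℕ i *ℚ a i m
      ≡⟨ cong (λ u → a i m +ℚ R *ℚ (u *ℚ a (suc i) m) +ℚ fromℕ i *ℚ a i m) (fromℕ-+ 1 i) ⟩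
  a i m +ℚ R *ℚ ((1ℚ +ℚ fromℕ i) *ℚ a (suc i) m) +ℚ fromℕ i *ℚ a i m
      ≡⟨ collect (a i m) R (fromℕ i) (a (suc i) m) ⟩
  (1ℚ +ℚ fromℕ i) *ℚ (R *ℚ a (suc i) m +ℚ a i m)
      ≡⟨ cong₂ _*ℚ_ (fromℕ-+ 1 i) (a-rec (suc i) m) ⟨
  I₊ *ℚ (M *ℚ a (suc i) (suc m))
      ≡⟨ solve 3 (λ x y z → x :* (y :* z) := y :* (x :* z)) refl I₊ M (a (suc i) (suc m)) ⟩
  M *ℚ (I₊ *ℚ a (suc i) (suc m)) ∎)
  where
  open ≡-Reasoning
  M R I₊ : ℚ
  M = fromℕ (suc m)
  R = fromℕ (ρ + m)
  I₊ = fromℕ (suc i)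

  logConv-previous : ∀ i → logConv (previous a i) m ≡ fromℕ i *ℚ a i m
  logConv-previous zero = begin
    Σ< m (λ t → 0ℚ *ℚ 1/suc (m ∸ suc t)) ≡⟨ *-distribˡ-Σ< m 0ℚ (λ t → 1/suc (m ∸ suc t)) ⟨
    0ℚ *ℚ Σ< m (λ t → 1/suc (m ∸ suc t)) ≡⟨ ℚ.*-zeroˡ (Σ< m (λ t → 1/suc (m ∸ suc t))) ⟩
    0ℚ                                   ≡⟨ ℚ.*-zeroˡ (a 0 m) ⟨
    0ℚ *ℚ a 0 m                          ∎
  logConv-previous (suc i) = logConv-ladder ρ a a-suc-0 a-rec i m

  collect : ∀ a₀ r j a₁ → a₀ +ℚ r *ℚ ((1ℚ +ℚ j) *ℚ a₁) +ℚ j *ℚ a₀ ≡ (1ℚ +ℚ j) *ℚ (r *ℚ a₁ +ℚ a₀)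
  collect = solve 4 (λ a₀ r j a₁ → a₀ :+ r :* ((con 1ℚ :+ j) :* a₁) :+ j :* a₀
                                  := (con 1ℚ :+ j) :* (r :* a₁ :+ a₀)) refl

≤ᵇ≡false : ∀ {m n} → n < m → (m ≤ᵇ n) ≡ false
≤ᵇ≡false {m} {n} n<m with m ≤ᵇ n in m≤ᵇn
... | false = refl
... | true  = contradiction (ℕ.≤ᵇ⇒≤ m n (subst T (sym m≤ᵇn) tt)) (ℕ.<⇒≱ n<m)

rStirAux-<r : ∀ r m {k} → k < r → rStirAux r m k ≡ 0
rStirAux-<r r zero    {k}     k<r = cong (if_then (if k ≤ᵇ r then 1 else 0) else 0) (≤ᵇ≡false k<r)
rStirAux-<r r (suc m) {zero}  k<r =
  trans (cong ((r + m) *_) (rStirAux-<r r m k<r)) (ℕ.*-zeroʳ (r + m))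
rStirAux-<r r (suc m) {suc k} k<r =
  cong₂ _+_ (trans (cong ((r + m) *_) (rStirAux-<r r m k<r)) (ℕ.*-zeroʳ (r + m)))
            (rStirAux-<r r m (ℕ.<⇒≤ k<r))

rStirAux-zero->r : ∀ r {k} → r < k → rStirAux r zero k ≡ 0
rStirAux-zero->r r {k} r<k = trans (if-cong-then (r ≤ᵇ k) (if-cong (≤ᵇ≡false r<k))) (if-eta (r ≤ᵇ k))

rStirAux-suc-r : ∀ r m → rStirAux r (suc m) r ≡ (r + m) * rStirAux r m r + 0
rStirAux-suc-r zero    m = sym (ℕ.+-identityʳ _)
rStirAux-suc-r (suc r) m = cong (_+_ ((suc r + m) * rStirAux (suc r) m (suc r))) (rStirAux-<r (suc r) m (ℕ.n<1+n r))

rStir-+r : ∀ r t k → rStir r (t + r) k ≡ rStirAux r t k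
rStir-+r r t k with r ≤ᵇ t + r | ℕ.≤⇒≤ᵇ (ℕ.m≤n+m r t)
... | true | _ = cong (λ m → rStirAux r m k) (ℕ.m+n∸n≡m t r)

stirling! : ℕ → ℕ → ℕ → ℚ
stirling! r i t = div! (rStirAux r t (i + r)) t

stirling!-suc-0 : ∀ r i → stirling! r (suc i) 0 ≡ 0ℚ
stirling!-suc-0 r i =
  trans (cong (λ n → div! n 0) (rStirAux-zero->r r (s≤s (ℕ.m≤n+m r i)))) (div!-0 0)

stirling!-suc : ∀ r i t →
  fromℕ (suc t) *ℚ stirling! r i (suc t) ≡ fromℕ (r + t) *ℚ stirling! r i t +ℚ previous (stirling! r) i t
stirling!-suc r zero    t = trans (div!-recurrence (r + t) _ _ 0 t (rStirAux-suc-r r t))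
                                  (cong (fromℕ (r + t) *ℚ stirling! r 0 t +ℚ_) (div!-0 t))
stirling!-suc r (suc i) t = div!-recurrence (r + t) _ _ _ t refl

mainTheorem4 : (i j r : ℕ) → i ≤ j →
    sumTo j (λ t → frac! (rStir r (t + r) (i + r)) t (j ∸ t))
      ≡ div! (suc i * rStir r (j + r + 1) (i + r + 1)) (suc j)
mainTheorem4 i j r _ = begin
  sumTo j summand                                       ≡⟨ sumTo≡Σ< j summand ⟩
  Σ< (suc j) summand                                    ≡⟨ Σ<-cong (suc j) (λ t _ → summand≡ t) ⟩
  logConv (stirling! r i) (suc j)                       ≡⟨ logConv-ladder r (stirling! r) (stirling!-suc-0 r) (stirling!-suc r) i (suc j) ⟩
  fromℕ (suc i) *ℚ stirling! r (suc i) (suc j)          ≡⟨ fromℕ*div! (suc i) (rStirAux r (suc j) (suc i + r)) (suc j) ⟩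
  div! (suc i * rStirAux r (suc j) (suc i + r)) (suc j) ≡⟨ cong (λ n → div! (suc i * n) (suc j)) rStir≡ ⟨
  div! (suc i * rStir r (j + r + 1) (i + r + 1)) (suc j) ∎
  where
  open ≡-Reasoning
  summand : ℕ → ℚ
  summand t = frac! (rStir r (t + r) (i + r)) t (j ∸ t)

  summand≡ : ∀ t → summand t ≡ stirling! r i t *ℚ 1/suc (j ∸ t)
  summand≡ t = trans (cong (λ n → frac! n t (j ∸ t)) (rStir-+r r t (i + r)))
                     (frac!≡div!*1/suc (rStirAux r t (i + r)) t (j ∸ t))

  rStir≡ : rStir r (j + r + 1) (i + r + 1) ≡ rStirAux r (suc j) (suc i + r)
  rStir≡ = trans (cong₂ (rStir r) (ℕ.+-comm (j + r) 1) (ℕ.+-comm (i + r) 1))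
                 (rStir-+r r (suc j) (suc i + r))
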